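{- Let $\mathbf{G}=(G,*)$ be a commutative groupoid. If $s^{\mathrm{ac}}_n(\mathbf{G})=D_{n-1}$ for $n\in\mathbb{N}_+$, then $\mathbf{G}$ is totally nonassociative, i.e., $s_n(\mathbf{G})=C_{n-1}$ for all $n\in\mathbb{N}_+$.
   Context: A groupoid is a nonempty set with a binary operation. For $X_n=\{x_1,\dots,x_n\}$, groupoid terms over $X_n$ are built recursively from variables by $(s,t)\mapsto (st)$. A full linear term over $X_n$ is a term in which each of $x_1,\dots,x_n$ occurs exactly once; a bracketing over $X_n$ is a full linear term in which the variables appear in the order $x_1,x_2,\dots,x_n$ from left to right. Each term induces an $n$-ary term operation on $\mathbf{G}$. The ac-spectrum $s^{\mathrm{ac}}_n(\mathbf{G})$ is the number of distinct term operations induced by full linear terms over $X_n$; the associative spectrum $s_n(\mathbf{G})$ is the number of distinct term operations induced by bracketings over $X_n$. $C_m=\frac{1}{m+1}\binom{2m}{m}$ is the Catalan number and $D_m=(2m)!/(2^m m!)$. -}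

module Defs where

open import Data.Nat using (ℕ; zero; suc; _+_; _*_; _^_; _/_; _!; NonZero)
open import Data.Nat.Properties using (m*n≢0; m^n≢0; _!≢0)
open import Data.Nat.Combinatorics using (_C_)
open import Data.Fin using (Fin)
open import Data.Fin.Properties using () renaming (_≟_ to _≟ᶠ_)
open import Data.List using (List; []; [_]; _++_; allFin)
open import Data.Vec using (Vec; lookup)
open import Data.Product using (Σ; ∃; _×_)
open import Relation.Binary.PropositionalEquality using (_≡_)
open import Relation.Nullary using (yes; no)

Catalan : ℕ → ℕ
Catalan m = ((2 * m) C m) / suc m

D : ℕ → ℕ
D m = _/_ ((2 * m) !) (2 ^ m * m !) {{m*n≢0 (2 ^ m) (m !) {{m^n≢0 2 m}} {{m !≢0}}}}

-- groupoid terms over X_n = {x_1,...,x_n} (variables indexed by Fin n)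
data Term (n : ℕ) : Set where
  var : Fin n → Term n
  _·_ : Term n → Term n → Term n

occ : ∀ {n} → Fin n → Term n → ℕ
occ i (var j) with i ≟ᶠ j
... | yes _ = 1
... | no _ = 0
occ i (s · t) = occ i s + occ i t

leaves : ∀ {n} → Term n → List (Fin n)
leaves (var j) = [ j ]
leaves (s · t) = leaves s ++ leaves t

FullLinear : ∀ {n} → Term n → Set
FullLinear {n} t = (i : Fin n) → occ i t ≡ 1

Bracketing : ∀ {n} → Term n → Set
Bracketing {n} t = FullLinear t × (leaves t ≡ allFin n)

eval : ∀ {n} {G : Set} → (G → G → G) → (Fin n → G) → Term n → G
eval _*_ ρ (var i) = ρ i
eval _*_ ρ (s · t) = eval _*_ ρ s * eval _*_ ρ t

SameOp : ∀ {n} {G : Set} → (G → G → G) → Term n → Term n → Set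
SameOp {n} {G} _*_ s t = (ρ : Fin n → G) → eval _*_ ρ s ≡ eval _*_ ρ t

NumOps : ∀ {n} {G : Set} → (G → G → G) → (Term n → Set) → ℕ → Set
NumOps {n} _*_ P k =
  Σ (Vec (Term n) k) λ v →
    ((i : Fin k) → P (lookup v i))
    × ((i j : Fin k) → SameOp _*_ (lookup v i) (lookup v j) → i ≡ j)
    × ((t : Term n) → P t → ∃ λ i → SameOp _*_ t (lookup v i))

acSpectrum≡ : {G : Set} → (G → G → G) → ℕ → ℕ → Set
acSpectrum≡ {G} _*_ n k = NumOps {n} {G} _*_ FullLinear k

assocSpectrum≡ : {G : Set} → (G → G → G) → ℕ → ℕ → Set
assocSpectrum≡ {G} _*_ n k = NumOps {n} {G} _*_ Bracketing k

-- Swapping the factors of a product never changes a term operation of a commutative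
-- groupoid, so each full linear term over X_{m+1} induces the same operation as one of the
-- D_m terms grown from x₁ by grafting x₂, …, x_{m+1} in turn onto one of the 2k − 1 nodes of
-- the current term (Rémy's construction; every full linear term is one of these up to swaps).
-- If s^ac_{m+1} = D_m, these D_m swap classes must therefore be exactly the fibres of the
-- term-operation map. Two bracketings that agree up to swaps are equal, because a swap at any
-- node would move its leftmost variable to the right of variables that precede it; hence the
-- bracketings induce pairwise distinct operations, and there are C_m of them, the number of
-- binary trees with m internal nodes. That number c_m satisfies c_{n+1} = Σ_{i+j=n} c_i c_j;
-- weighting each summand by (i + 1) + (j + 1) = n + 2 and using induction on the factor
-- (i + 1) c_i gives (n + 2) c_{n+1} = (4n + 2) c_n, hence c_m = binom(2m, m)/(m + 1).

module Submission where

open import Defs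
open import Algebra.Definitions using (Commutative)
open import Data.Empty using (⊥-elim)
open import Data.Fin using (Fin; zero; suc; inject₁; fromℕ; punchOut)
open import Data.Fin.Properties using (any?; punchOut-injective; injective⇒≤; inject₁-injective; fromℕ≢inject₁)
  renaming (_≟_ to _≟ᶠ_)
open import Data.Fin.Relation.Unary.Top using (view; ‵fromℕ; ‵inject₁)
open import Data.List using (List; []; _∷_; [_]; _++_; length; map; concatMap; cartesianProductWith; take; drop; allFin; lookup)
open import Data.List.Properties
  using (∷-injective; ∷-injectiveˡ; length-++; length-map; length-take; length-drop; take++drop≡id; length-tabulate; map-tabulate)
open import Data.List.Membership.Propositional using (_∈_; find)
open import Data.List.Membership.Propositional.Properties
  using (∈-++⁺ˡ; ∈-++⁺ʳ; ∈-++⁻; ∈-map⁺; ∈-map⁻; ∈-concatMap⁺; ∈-concatMap⁻; ∈-cartesianProductWith⁺; ∈-cartesianProductWith⁻; ∈-lookup)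
open import Data.List.Relation.Unary.All as All using (All; []; _∷_)
open import Data.List.Relation.Unary.AllPairs using ([]; _∷_)
open import Data.List.Relation.Unary.Any as Any using (here; there; index)
open import Data.List.Relation.Unary.Any.Properties using (lookup-index)
open import Data.List.Relation.Unary.Unique.Propositional using (Unique)
import Data.List.Relation.Unary.Unique.Propositional.Properties as Unique
open import Data.Nat using (ℕ; zero; suc; _+_; _*_; _∸_; _^_; _/_; _!; _≤_; _<_; z≤n; s≤s; NonZero)
open import Data.Nat.Combinatorics using (_C_; nCk≡n!/k![n-k]!)
open import Data.Nat.DivMod using (m*n/n≡m)
open import Data.Nat.Induction using (<-rec)
open import Data.Nat.Properties
open import Algebra.Properties.CommutativeSemigroup +-commutativeSemigroup using () renaming (interchange to +-interchange)
open import Data.Nat.Tactic.RingSolver using (solve-∀)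
open import Data.Product using (∃; ∃₂; _×_; _,_; proj₁; proj₂)
import Data.Product as Product
open import Data.Sum using (_⊎_; inj₁; inj₂)
open import Data.Vec using (Vec) renaming (lookup to lookupᵥ; tabulate to tabulateᵥ)
open import Data.Vec.Properties using (lookup∘tabulate)
open import Function using (_∘_; id)
open import Relation.Binary.Structures using (IsEquivalence)
open import Relation.Nullary using (yes; no; ¬_)
open import Relation.Binary.PropositionalEquality hiding ([_])
open ≡-Reasoning

private
  variable
    n : ℕ

++-injective : ∀ {A : Set} (xs : List A) {ys zs ws : List A} →
               length xs ≡ length zs → xs ++ ys ≡ zs ++ ws → xs ≡ zs × ys ≡ ws
++-injective []       {zs = []}     _ eq = refl , eq
++-injective (x ∷ xs) {zs = z ∷ zs} l eq with ∷-injective eq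
... | refl , eq′ = Product.map₁ (cong (x ∷_)) (++-injective xs (suc-injective l) eq′)

m+n≡1-cases : ∀ m n → m + n ≡ 1 → (m ≡ 0 × n ≡ 1) ⊎ (m ≡ 1 × n ≡ 0)
m+n≡1-cases zero          n    eq = inj₁ (refl , eq)
m+n≡1-cases (suc zero)    zero _  = inj₂ (refl , refl)

lookup-injective : ∀ {A : Set} {xs : List A} → Unique xs →
                   ∀ {i j} → lookup xs i ≡ lookup xs j → i ≡ j
lookup-injective (_  ∷ u)  {zero}  {zero}  _  = refl
lookup-injective (x∉ ∷ _)  {zero}  {suc j} eq = ⊥-elim (All.lookup x∉ (∈-lookup j) eq)
lookup-injective (x∉ ∷ _)  {suc i} {zero}  eq = ⊥-elim (All.lookup x∉ (∈-lookup i) (sym eq))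
lookup-injective (_  ∷ u)  {suc i} {suc j} eq = cong suc (lookup-injective u eq)

length-concatMap : ∀ {A B : Set} (f : A → List B) {k : ℕ} {xs : List A} →
                   All (λ x → length (f x) ≡ k) xs → length (concatMap f xs) ≡ length xs * k
length-concatMap f []                        = refl
length-concatMap f {xs = x ∷ xs} (fx ∷ fxs) =
  trans (length-++ (f x)) (cong₂ _+_ fx (length-concatMap f fxs))

length-cartesianProductWith : ∀ {A B C : Set} (f : A → B → C) (xs : List A) (ys : List B) →
                              length (cartesianProductWith f xs ys) ≡ length xs * length ys
length-cartesianProductWith f []       ys = refl
length-cartesianProductWith f (x ∷ xs) ys =
  trans (length-++ (map (f x) ys))
        (cong₂ _+_ (length-map (f x) ys) (length-cartesianProductWith f xs ys))

injective⇒surjective : (f : Fin n → Fin n) → (∀ {x y} → f x ≡ f y → x ≡ y) →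
                       ∀ y → ∃ λ x → f x ≡ y
injective⇒surjective f f-inj y with any? (λ x → f x ≟ᶠ y)
... | yes hit = hit
injective⇒surjective {suc n} f f-inj y | no miss = ⊥-elim (<-irrefl refl (injective⇒≤ g-inj))
  where
    g : Fin (suc n) → Fin n
    g x = punchOut {i = y} (λ y≡fx → miss (x , sym y≡fx))
    g-inj : ∀ {x x′} → g x ≡ g x′ → x ≡ x′
    g-inj {x} {x′} eq = f-inj (punchOut-injective (λ e → miss (x , sym e)) (λ e → miss (x′ , sym e)) eq)

-- Swapping factors

infix 4 _~_

data _~_ {n : ℕ} : Term n → Term n → Set where
  var  : ∀ i → var i ~ var i
  _·_  : ∀ {a b a′ b′} → a ~ a′ → b ~ b′ → a · b ~ a′ · b′
  swap : ∀ {a b a′ b′} → a ~ b′ → b ~ a′ → a · b ~ a′ · b′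

~-refl : {t : Term n} → t ~ t
~-refl {t = var i} = var i
~-refl {t = a · b} = ~-refl · ~-refl

~-sym : {s t : Term n} → s ~ t → t ~ s
~-sym (var i)    = var i
~-sym (p · q)    = ~-sym p · ~-sym q
~-sym (swap p q) = swap (~-sym q) (~-sym p)

~-trans : {s t u : Term n} → s ~ t → t ~ u → s ~ u
~-trans (var i)    q          = q
~-trans (p · q)    (r · s)    = ~-trans p r · ~-trans q s
~-trans (p · q)    (swap r s) = swap (~-trans p r) (~-trans q s)
~-trans (swap p q) (r · s)    = swap (~-trans p s) (~-trans q r)
~-trans (swap p q) (swap r s) = ~-trans p s · ~-trans q r

~-isEquivalence : IsEquivalence (_~_ {n})
~-isEquivalence = record { refl = ~-refl ; sym = ~-sym ; trans = ~-trans }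

~⇒SameOp : {G : Set} {_*_ : G → G → G} → Commutative _≡_ _*_ →
           {s t : Term n} → s ~ t → SameOp _*_ s t
~⇒SameOp             comm (var i)    ρ = refl
~⇒SameOp {_*_ = _*_} comm (p · q)    ρ = cong₂ _*_ (~⇒SameOp comm p ρ) (~⇒SameOp comm q ρ)
~⇒SameOp {_*_ = _*_} comm (swap p q) ρ =
  trans (cong₂ _*_ (~⇒SameOp comm p ρ) (~⇒SameOp comm q ρ)) (comm _ _)

~⇒occ≡ : {s t : Term n} → s ~ t → ∀ i → occ i s ≡ occ i t
~⇒occ≡ (var j)    i = refl
~⇒occ≡ (p · q)    i = cong₂ _+_ (~⇒occ≡ p i) (~⇒occ≡ q i)
~⇒occ≡ (swap {a′ = a′} {b′} p q) i =
  trans (cong₂ _+_ (~⇒occ≡ p i) (~⇒occ≡ q i)) (+-comm (occ i b′) (occ i a′))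

~⇒length-leaves≡ : {s t : Term n} → s ~ t → length (leaves s) ≡ length (leaves t)
~⇒length-leaves≡ (var j) = refl
~⇒length-leaves≡ (_·_ {a} {b} {a′} {b′} p q) = begin
  length (leaves a ++ leaves b)              ≡⟨ length-++ (leaves a) ⟩
  length (leaves a) + length (leaves b)      ≡⟨ cong₂ _+_ (~⇒length-leaves≡ p) (~⇒length-leaves≡ q) ⟩
  length (leaves a′) + length (leaves b′)    ≡⟨ length-++ (leaves a′) ⟨
  length (leaves a′ ++ leaves b′)            ∎
~⇒length-leaves≡ (swap {a} {b} {a′} {b′} p q) = begin
  length (leaves a ++ leaves b)              ≡⟨ length-++ (leaves a) ⟩
  length (leaves a) + length (leaves b)      ≡⟨ cong₂ _+_ (~⇒length-leaves≡ p) (~⇒length-leaves≡ q) ⟩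
  length (leaves b′) + length (leaves a′)    ≡⟨ +-comm (length (leaves b′)) _ ⟩
  length (leaves a′) + length (leaves b′)    ≡⟨ length-++ (leaves a′) ⟨
  length (leaves a′ ++ leaves b′)            ∎

occ-var-self : (i : Fin n) → occ i (var i) ≡ 1
occ-var-self i with i ≟ᶠ i
... | yes _  = refl
... | no i≢i = ⊥-elim (i≢i refl)

occ-var-≢ : {i j : Fin n} → i ≢ j → occ i (var j) ≡ 0
occ-var-≢ {i = i} {j} i≢j with i ≟ᶠ j
... | yes i≡j = ⊥-elim (i≢j i≡j)
... | no _    = refl

first : Term n → Fin n
first (var i) = i
first (a · b) = first a

rest : Term n → List (Fin n)
rest (var i) = []
rest (a · b) = rest a ++ leaves b

leaves≡first∷rest : (t : Term n) → leaves t ≡ first t ∷ rest t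
leaves≡first∷rest (var i) = refl
leaves≡first∷rest (a · b) = cong (_++ leaves b) (leaves≡first∷rest a)

occ-first : (t : Term n) → 1 ≤ occ (first t) t
occ-first (var i) = ≤-reflexive (sym (occ-var-self i))
occ-first (a · b) = ≤-trans (occ-first a) (m≤m+n _ _)

-- A swap would put the common leftmost variable into both factors of t.
~-rigid : {s t : Term n} → s ~ t → leaves s ≡ leaves t → (∀ i → occ i t ≤ 1) → s ≡ t
~-rigid (var i) _ _ = refl
~-rigid (_·_ {a} {b} {a′} {b′} p q) same-leaves linear
  with ++-injective (leaves a) (~⇒length-leaves≡ p) same-leaves
... | leaves-a , leaves-b =
  cong₂ _·_ (~-rigid p leaves-a (λ i → ≤-trans (m≤m+n _ _) (linear i)))
            (~-rigid q leaves-b (λ i → ≤-trans (m≤n+m _ _) (linear i)))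
~-rigid (swap {a} {b} {a′} {b′} p q) same-leaves linear =
  ⊥-elim (<-irrefl refl (≤-trans (+-mono-≤ in-a′ in-b′) (linear (first a))))
  where
    same-first : first a ≡ first a′
    same-first = ∷-injectiveˡ (trans (sym (leaves≡first∷rest (a · b)))
                                     (trans same-leaves (leaves≡first∷rest (a′ · b′))))
    in-a′ : 1 ≤ occ (first a) a′
    in-a′ = subst (λ x → 1 ≤ occ x a′) (sym same-first) (occ-first a′)
    in-b′ : 1 ≤ occ (first a) b′
    in-b′ = subst (1 ≤_) (~⇒occ≡ p (first a)) (occ-first a)

-- Grafting a new variable

data Node {n : ℕ} : Term n → Set where
  here  : ∀ {t} → Node t
  left  : ∀ {a b} → Node a → Node (a · b)
  right : ∀ {a b} → Node b → Node (a · b)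

weaken : Term n → Term (suc n)
weaken (var i) = var (inject₁ i)
weaken (a · b) = weaken a · weaken b

graft : (t : Term n) → Node t → Term (suc n)
graft {n} t       here      = weaken t · var (fromℕ n)
graft     (a · b) (left p)  = graft a p · weaken b
graft     (a · b) (right p) = weaken a · graft b p

nodes : (t : Term n) → List (Node t)
nodes (var i) = [ here ]
nodes (a · b) = here ∷ map left (nodes a) ++ map right (nodes b)

∈-nodes : {t : Term n} (p : Node t) → p ∈ nodes t
∈-nodes {t = var i} here      = here refl
∈-nodes {t = a · b} here      = here refl
∈-nodes {t = a · b} (left p)  = there (∈-++⁺ˡ (∈-map⁺ left (∈-nodes p)))
∈-nodes {t = a · b} (right p) = there (∈-++⁺ʳ (map left (nodes a)) (∈-map⁺ right (∈-nodes p)))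

size : Term n → ℕ
size (var i) = 1
size (a · b) = suc (size a + size b)

length-nodes : (t : Term n) → length (nodes t) ≡ size t
length-nodes (var i) = refl
length-nodes (a · b) = cong suc (begin
  length (map left (nodes a) ++ map right (nodes b))
    ≡⟨ length-++ (map left (nodes a)) ⟩
  length (map left (nodes a)) + length (map right (nodes b))
    ≡⟨ cong₂ _+_ (length-map left (nodes a)) (length-map right (nodes b)) ⟩
  length (nodes a) + length (nodes b)
    ≡⟨ cong₂ _+_ (length-nodes a) (length-nodes b) ⟩
  size a + size b ∎)

size-weaken : (t : Term n) → size (weaken t) ≡ size t
size-weaken (var i) = refl
size-weaken (a · b) = cong suc (cong₂ _+_ (size-weaken a) (size-weaken b))

size-graft : (t : Term n) (p : Node t) → size (graft t p) ≡ 2 + size t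
size-graft t here = cong suc (trans (cong (_+ 1) (size-weaken t)) (+-comm (size t) 1))
size-graft (a · b) (left p) =
  cong suc (cong₂ _+_ (size-graft a p) (size-weaken b))
size-graft (a · b) (right p) = cong suc (begin
  size (weaken a) + size (graft b p)  ≡⟨ cong₂ _+_ (size-weaken a) (size-graft b p) ⟩
  size a + suc (suc (size b))         ≡⟨ +-suc (size a) _ ⟩
  suc (size a + suc (size b))         ≡⟨ cong suc (+-suc (size a) (size b)) ⟩
  suc (suc (size a + size b))         ∎)

weaken-resp-~ : {a b : Term n} → a ~ b → weaken a ~ weaken b
weaken-resp-~ (var i)    = var _
weaken-resp-~ (p · q)    = weaken-resp-~ p · weaken-resp-~ q
weaken-resp-~ (swap p q) = swap (weaken-resp-~ p) (weaken-resp-~ q)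

graft-resp-~ : {t t′ : Term n} → t ~ t′ → (p : Node t) → ∃ λ p′ → graft t p ~ graft t′ p′
graft-resp-~ t~t′ here = here , weaken-resp-~ t~t′ · var _
graft-resp-~ (a~ · b~) (left p)    = Product.map left  (_· weaken-resp-~ b~) (graft-resp-~ a~ p)
graft-resp-~ (a~ · b~) (right p)   = Product.map right (weaken-resp-~ a~ ·_) (graft-resp-~ b~ p)
graft-resp-~ (swap a~ b~) (left p)  = Product.map right (λ g~ → swap g~ (weaken-resp-~ b~)) (graft-resp-~ a~ p)
graft-resp-~ (swap a~ b~) (right p) = Product.map left  (swap (weaken-resp-~ a~)) (graft-resp-~ b~ p)

occ-weaken : (i : Fin n) (t : Term n) → occ (inject₁ i) (weaken t) ≡ occ i t
occ-weaken i (var j) with i ≟ᶠ j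
... | yes refl = occ-var-self (inject₁ i)
... | no i≢j   = occ-var-≢ (i≢j ∘ inject₁-injective)
occ-weaken i (a · b) = cong₂ _+_ (occ-weaken i a) (occ-weaken i b)

occ-last-weaken : (t : Term n) → occ (fromℕ n) (weaken t) ≡ 0
occ-last-weaken (var j) = occ-var-≢ fromℕ≢inject₁
occ-last-weaken (a · b) = cong₂ _+_ (occ-last-weaken a) (occ-last-weaken b)

occ-graft : (i : Fin n) (t : Term n) (p : Node t) → occ (inject₁ i) (graft t p) ≡ occ i t
occ-graft i t here =
  trans (cong₂ _+_ (occ-weaken i t) (occ-var-≢ (fromℕ≢inject₁ ∘ sym))) (+-identityʳ _)
occ-graft i (a · b) (left p)  = cong₂ _+_ (occ-graft i a p) (occ-weaken i b)
occ-graft i (a · b) (right p) = cong₂ _+_ (occ-weaken i a) (occ-graft i b p)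

occ-last≡0⇒weaken : (u : Term (suc n)) → occ (fromℕ n) u ≡ 0 → ∃ λ u′ → u ≡ weaken u′
occ-last≡0⇒weaken (var j) eq with view j
... | ‵fromℕ      = ⊥-elim (0≢1+n (trans (sym eq) (occ-var-self _)))
... | ‵inject₁ j′ = var j′ , refl
occ-last≡0⇒weaken (a · b) eq
  with occ-last≡0⇒weaken a (m+n≡0⇒m≡0 _ eq) | occ-last≡0⇒weaken b (m+n≡0⇒n≡0 (occ _ a) eq)
... | a′ , refl | b′ , refl = a′ · b′ , refl

occ-last≡1⇒graft : (u : Term (suc n)) → occ (fromℕ n) u ≡ 1 →
                   u ≡ var (fromℕ n) ⊎ ∃₂ λ u′ p → u ~ graft u′ p
occ-last≡1⇒graft (var j) eq with view j
... | ‵fromℕ      = inj₁ refl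
... | ‵inject₁ j′ = ⊥-elim (0≢1+n (trans (sym (occ-var-≢ fromℕ≢inject₁)) eq))
occ-last≡1⇒graft {n} (a · b) eq with m+n≡1-cases (occ (fromℕ n) a) _ eq
... | inj₁ (a₀ , b₁) with occ-last≡0⇒weaken a a₀ | occ-last≡1⇒graft b b₁
...   | a′ , refl | inj₁ refl            = inj₂ (a′ , here , ~-refl)
...   | a′ , refl | inj₂ (b′ , p , b~)   = inj₂ (a′ · b′ , right p , ~-refl · b~)
occ-last≡1⇒graft {n} (a · b) eq | inj₂ (a₁ , b₀) with occ-last≡0⇒weaken b b₀ | occ-last≡1⇒graft a a₁
...   | b′ , refl | inj₁ refl            = inj₂ (b′ , here , swap ~-refl ~-refl)
...   | b′ , refl | inj₂ (a′ , p , a~)   = inj₂ (a′ · b′ , left p , a~ · ~-refl)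

grafts : Term n → List (Term (suc n))
grafts t = map (graft t) (nodes t)

remyTerms : (m : ℕ) → List (Term (suc m))
remyTerms zero    = [ var zero ]
remyTerms (suc m) = concatMap grafts (remyTerms m)

size-remyTerms : ∀ m {t} → t ∈ remyTerms m → size t ≡ suc (2 * m)
size-remyTerms zero (here refl) = refl
size-remyTerms (suc m) t∈ with find (∈-concatMap⁻ grafts {xs = remyTerms m} t∈)
... | u , u∈ , t∈grafts with ∈-map⁻ (graft u) t∈grafts
... | p , _ , refl = begin
  size (graft u p)    ≡⟨ size-graft u p ⟩
  2 + size u          ≡⟨ cong (2 +_) (size-remyTerms m u∈) ⟩
  2 + suc (2 * m)     ≡⟨ cong suc (*-suc 2 m) ⟨
  suc (2 * suc m)     ∎

length-remyTerms-suc : ∀ m → length (remyTerms (suc m)) ≡ length (remyTerms m) * suc (2 * m)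
length-remyTerms-suc m = length-concatMap grafts (All.tabulate λ {t} t∈ →
  trans (length-map (graft t) (nodes t)) (trans (length-nodes t) (size-remyTerms m t∈)))

∈-remyTerms-graft : ∀ {m t} → t ∈ remyTerms m → (p : Node t) → graft t p ∈ remyTerms (suc m)
∈-remyTerms-graft {t = t} t∈ p =
  ∈-concatMap⁺ grafts (Any.map (λ { refl → ∈-map⁺ (graft t) (∈-nodes p) }) t∈)

occ-zero-Term₁ : (t : Term 1) → 1 ≤ occ zero t
occ-zero-Term₁ t with first t | occ-first t
... | zero | occurs = occurs

remyTerms-complete : ∀ m {u : Term (suc m)} → FullLinear u → ∃ λ t → t ∈ remyTerms m × u ~ t
remyTerms-complete zero {var zero} _ = var zero , here refl , var zero
remyTerms-complete zero {a · b} linear =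
  ⊥-elim (<-irrefl refl (≤-trans (+-mono-≤ (occ-zero-Term₁ a) (occ-zero-Term₁ b)) (≤-reflexive (linear zero))))
remyTerms-complete (suc m) {u} linear with occ-last≡1⇒graft u (linear (fromℕ (suc m)))
... | inj₁ refl = ⊥-elim (0≢1+n (linear zero))
... | inj₂ (u′ , p , u~) with remyTerms-complete m u′-linear
  where
    u′-linear : FullLinear u′
    u′-linear i = trans (sym (occ-graft i u′ p)) (trans (sym (~⇒occ≡ u~ (inject₁ i))) (linear (inject₁ i)))
... | t , t∈ , u′~t with graft-resp-~ u′~t p
... | p′ , graft~ = graft t p′ , ∈-remyTerms-graft t∈ p′ , ~-trans u~ graft~

-- Counting equivalence classes

module _ {A : Set} (P : A → Set) {_≈_ _~′_ : A → A → Set}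
         (≈-isEquivalence : IsEquivalence _≈_) (~′-isEquivalence : IsEquivalence _~′_)
         (~′⇒≈ : ∀ {a b} → a ~′ b → a ≈ b)
         (reps : List A) (cover : ∀ {a} → P a → ∃ λ r → r ∈ reps × a ~′ r)
         (v : Vec A (length reps)) (P-v : ∀ i → P (lookupᵥ v i))
         (v-distinct : ∀ i j → lookupᵥ v i ≈ lookupᵥ v j → i ≡ j)
  where
  private
    module ≈ = IsEquivalence ≈-isEquivalence
    module ~′ = IsEquivalence ~′-isEquivalence

    classOf : ∀ {a} → P a → Fin (length reps)
    classOf pa = index (proj₁ (proj₂ (cover pa)))

    ~′-class : ∀ {a} (pa : P a) → a ~′ lookup reps (classOf pa)
    ~′-class {a} pa = subst (a ~′_) (lookup-index (proj₁ (proj₂ (cover pa)))) (proj₂ (proj₂ (cover pa)))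

    same-class⇒~′ : ∀ {a b} (pa : P a) (pb : P b) → classOf pa ≡ classOf pb → a ~′ b
    same-class⇒~′ pa pb eq =
      ~′.trans (~′-class pa) (~′.trans (~′.reflexive (cong (lookup reps) eq)) (~′.sym (~′-class pb)))

    class-v-injective : ∀ {i j} → classOf (P-v i) ≡ classOf (P-v j) → i ≡ j
    class-v-injective {i} {j} eq = v-distinct i j (~′⇒≈ (same-class⇒~′ (P-v i) (P-v j) eq))

  -- The k representatives of v meet k classes of ~′, hence every class.
  ≈⇒~′ : ∀ {a b} → P a → P b → a ≈ b → a ~′ b
  ≈⇒~′ pa pb a≈b
    with injective⇒surjective (λ i → classOf (P-v i)) class-v-injective (classOf pa)
       | injective⇒surjective (λ i → classOf (P-v i)) class-v-injective (classOf pb)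
  ... | i , i↦a | j , j↦b = same-class⇒~′ pa pb (trans (sym i↦a) (trans (cong (λ k → classOf (P-v k)) i≡j) j↦b))
    where
      i≡j : i ≡ j
      i≡j = v-distinct i j (≈.trans (~′⇒≈ (same-class⇒~′ (P-v i) pa i↦a))
                                    (≈.trans a≈b (~′⇒≈ (same-class⇒~′ pb (P-v j) (sym j↦b)))))

SameOp-isEquivalence : {G : Set} (_*_ : G → G → G) → IsEquivalence (SameOp {n} _*_)
SameOp-isEquivalence _*_ = record
  { refl  = λ ρ → refl
  ; sym   = λ s≈t ρ → sym (s≈t ρ)
  ; trans = λ s≈t t≈u ρ → trans (s≈t ρ) (t≈u ρ)
  }

m≡n*o⇒m/o≡n : ∀ m n o .{{_ : NonZero o}} → m ≡ n * o → m / o ≡ n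
m≡n*o⇒m/o≡n _ n o refl = m*n/n≡m n o

[2+2m]! : ∀ m → (2 * suc m) ! ≡ (2 + 2 * m) * ((1 + 2 * m) * (2 * m) !)
[2+2m]! m = cong _! (*-suc 2 m)

length-remyTerms*2^m*m! : ∀ m → length (remyTerms m) * (2 ^ m * m !) ≡ (2 * m) !
length-remyTerms*2^m*m! zero    = refl
length-remyTerms*2^m*m! (suc m) = begin
    length (remyTerms (suc m)) * (2 ^ suc m * suc m !)
  ≡⟨ cong (_* (2 ^ suc m * suc m !)) (length-remyTerms-suc m) ⟩
    length (remyTerms m) * suc (2 * m) * (2 * 2 ^ m * (suc m * m !))
  ≡⟨ regroup (length (remyTerms m)) (2 ^ m) (m !) m ⟩
    (2 + 2 * m) * ((1 + 2 * m) * (length (remyTerms m) * (2 ^ m * m !)))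
  ≡⟨ cong (λ x → (2 + 2 * m) * ((1 + 2 * m) * x)) (length-remyTerms*2^m*m! m) ⟩
    (2 + 2 * m) * ((1 + 2 * m) * (2 * m) !)
  ≡⟨ [2+2m]! m ⟨
    (2 * suc m) !
  ∎
  where
    regroup : ∀ x p f m → x * suc (2 * m) * (2 * p * (suc m * f))
                          ≡ (2 + 2 * m) * ((1 + 2 * m) * (x * (p * f)))
    regroup = solve-∀

length-remyTerms : ∀ m → length (remyTerms m) ≡ D m
length-remyTerms m = sym (m≡n*o⇒m/o≡n _ _ _ {{m*n≢0 (2 ^ m) (m !) {{m^n≢0 2 m}} {{m !≢0}}}}
                                        (sym (length-remyTerms*2^m*m! m)))

sameOp⇒~ : {G : Set} {_*_ : G → G → G} → Commutative _≡_ _*_ → ∀ {m} →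
           NumOps _*_ FullLinear (D m) → {s t : Term (suc m)} →
           FullLinear s → FullLinear t → SameOp _*_ s t → s ~ t
sameOp⇒~ {_*_ = _*_} comm {m} ops with subst (NumOps _*_ FullLinear) (sym (length-remyTerms m)) ops
... | v , linear , distinct , _ =
  ≈⇒~′ FullLinear (SameOp-isEquivalence _*_) ~-isEquivalence (~⇒SameOp comm)
       (remyTerms m) (remyTerms-complete m) v linear distinct

-- Binary trees

data Shape : Set where
  leaf : Shape
  node : Shape → Shape → Shape

inner : Shape → ℕ
inner leaf       = 0
inner (node a b) = suc (inner a + inner b)

node-injective : ∀ {a b c d} → node a b ≡ node c d → a ≡ c × b ≡ d
node-injective refl = refl , refl

convolution : (ℕ → ℕ) → (ℕ → ℕ) → ℕ → ℕ
convolution F H zero    = F 0 * H 0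
convolution F H (suc n) = F 0 * H (suc n) + convolution (F ∘ suc) H n

products : (ℕ → List Shape) → (ℕ → List Shape) → ℕ → List Shape
products F H zero    = cartesianProductWith node (F 0) (H 0)
products F H (suc n) = cartesianProductWith node (F 0) (H (suc n)) ++ products (F ∘ suc) H n

∈-products⁺ : ∀ F H {n} i j {a b} → i + j ≡ n → a ∈ F i → b ∈ H j → node a b ∈ products F H n
∈-products⁺ F H {zero}  zero    zero refl a∈ b∈ = ∈-cartesianProductWith⁺ node a∈ b∈
∈-products⁺ F H {suc n} zero    j    refl a∈ b∈ = ∈-++⁺ˡ (∈-cartesianProductWith⁺ node a∈ b∈)
∈-products⁺ F H {suc n} (suc i) j    eq   a∈ b∈ =
  ∈-++⁺ʳ _ (∈-products⁺ (F ∘ suc) H i j (suc-injective eq) a∈ b∈)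

∈-products⁻ : ∀ F H n {t} → t ∈ products F H n →
              ∃₂ λ i j → i + j ≡ n × ∃₂ λ a b → a ∈ F i × b ∈ H j × t ≡ node a b
∈-products⁻ F H zero t∈ with ∈-cartesianProductWith⁻ node (F 0) (H 0) t∈
... | a , b , a∈ , b∈ , eq = 0 , 0 , refl , a , b , a∈ , b∈ , eq
∈-products⁻ F H (suc n) t∈ with ∈-++⁻ (cartesianProductWith node (F 0) (H (suc n))) t∈
... | inj₁ t∈₀ with ∈-cartesianProductWith⁻ node (F 0) (H (suc n)) t∈₀
...   | a , b , a∈ , b∈ , eq = 0 , suc n , refl , a , b , a∈ , b∈ , eq
∈-products⁻ F H (suc n) t∈ | inj₂ t∈₊ with ∈-products⁻ (F ∘ suc) H n t∈₊
...   | i , j , i+j≡n , witnesses = suc i , j , cong suc i+j≡n , witnesses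

products-unique : ∀ F H n → (∀ i → Unique (F i)) → (∀ j → Unique (H j)) →
                  (∀ {i j a} → a ∈ F i → a ∈ F j → i ≡ j) → Unique (products F H n)
products-unique F H zero uF uH _ = Unique.cartesianProductWith⁺ node node-injective (uF 0) (uH 0)
products-unique F H (suc n) uF uH F-disjoint =
  Unique.++⁺ (Unique.cartesianProductWith⁺ node node-injective (uF 0) (uH (suc n)))
             (products-unique (F ∘ suc) H n (uF ∘ suc) uH (λ a∈ a∈′ → suc-injective (F-disjoint a∈ a∈′)))
             disjoint
  where
    disjoint : ∀ {t} → ¬ (t ∈ cartesianProductWith node (F 0) (H (suc n)) × t ∈ products (F ∘ suc) H n)
    disjoint (t∈₀ , t∈₊) with ∈-cartesianProductWith⁻ node (F 0) (H (suc n)) t∈₀ | ∈-products⁻ (F ∘ suc) H n t∈₊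
    ... | a , _ , a∈ , _ , refl | i , _ , _ , a′ , _ , a′∈ , _ , eq =
      0≢1+n (F-disjoint a∈ (subst (_∈ F (suc i)) (sym (proj₁ (node-injective eq))) a′∈))

length-products : ∀ F H n → length (products F H n) ≡ convolution (length ∘ F) (length ∘ H) n
length-products F H zero = length-cartesianProductWith node (F 0) (H 0)
length-products F H (suc n) =
  trans (length-++ (cartesianProductWith node (F 0) (H (suc n))))
        (cong₂ _+_ (length-cartesianProductWith node (F 0) (H (suc n))) (length-products (F ∘ suc) H n))

products-cong : ∀ {F F′ H H′} n → (∀ {i} → i ≤ n → F i ≡ F′ i) → (∀ {j} → j ≤ n → H j ≡ H′ j) →
                products F H n ≡ products F′ H′ n
products-cong zero    F≡ H≡ = cong₂ (cartesianProductWith node) (F≡ z≤n) (H≡ z≤n)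
products-cong (suc n) F≡ H≡ =
  cong₂ _++_ (cong₂ (cartesianProductWith node) (F≡ z≤n) (H≡ ≤-refl))
             (products-cong n (F≡ ∘ s≤s) (H≡ ∘ m≤n⇒m≤1+n))

convolution-cong : ∀ {F F′ H H′} n → (∀ {i} → i ≤ n → F i ≡ F′ i) → (∀ {j} → j ≤ n → H j ≡ H′ j) →
                   convolution F H n ≡ convolution F′ H′ n
convolution-cong zero    F≡ H≡ = cong₂ _*_ (F≡ z≤n) (H≡ z≤n)
convolution-cong (suc n) F≡ H≡ =
  cong₂ _+_ (cong₂ _*_ (F≡ z≤n) (H≡ ≤-refl)) (convolution-cong n (F≡ ∘ s≤s) (H≡ ∘ m≤n⇒m≤1+n))

-- With too little fuel f (that is, n ≥ f) the list is incomplete.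
shapesᶠ : (f n : ℕ) → List Shape
shapesᶠ zero    _       = []
shapesᶠ (suc f) zero    = [ leaf ]
shapesᶠ (suc f) (suc n) = products (shapesᶠ f) (shapesᶠ f) n

shapes : ℕ → List Shape
shapes n = shapesᶠ (suc n) n

inner-shapesᶠ : ∀ f n {t} → t ∈ shapesᶠ f n → inner t ≡ n
inner-shapesᶠ (suc f) zero    (here refl) = refl
inner-shapesᶠ (suc f) (suc n) t∈ with ∈-products⁻ (shapesᶠ f) (shapesᶠ f) n t∈
... | i , j , refl , a , b , a∈ , b∈ , refl = cong₂ (λ x y → suc (x + y)) (inner-shapesᶠ f i a∈) (inner-shapesᶠ f j b∈)

shapesᶠ-complete : ∀ {f} t → inner t < f → t ∈ shapesᶠ f (inner t)
shapesᶠ-complete {suc f} leaf       _ = here refl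
shapesᶠ-complete {suc f} (node a b) (s≤s a+b<f) =
  ∈-products⁺ (shapesᶠ f) (shapesᶠ f) (inner a) (inner b) refl
    (shapesᶠ-complete a (≤-<-trans (m≤m+n _ _) a+b<f)) (shapesᶠ-complete b (≤-<-trans (m≤n+m _ _) a+b<f))

shapesᶠ-unique : ∀ f n → Unique (shapesᶠ f n)
shapesᶠ-unique zero    n       = []
shapesᶠ-unique (suc f) zero    = [] ∷ []
shapesᶠ-unique (suc f) (suc n) =
  products-unique (shapesᶠ f) (shapesᶠ f) n (shapesᶠ-unique f) (shapesᶠ-unique f)
    (λ {i} {j} a∈i a∈j → trans (sym (inner-shapesᶠ f i a∈i)) (inner-shapesᶠ f j a∈j))

shapesᶠ-fuel : ∀ {f f′} n → n < f → n < f′ → shapesᶠ f n ≡ shapesᶠ f′ n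
shapesᶠ-fuel {suc f} {suc f′} zero    _          _           = refl
shapesᶠ-fuel {suc f} {suc f′} (suc n) (s≤s n<f) (s≤s n<f′) =
  products-cong n (λ i≤n → shapesᶠ-fuel _ (<-≤-trans (s≤s i≤n) n<f) (<-≤-trans (s≤s i≤n) n<f′))
                  (λ j≤n → shapesᶠ-fuel _ (<-≤-trans (s≤s j≤n) n<f) (<-≤-trans (s≤s j≤n) n<f′))

length-shapes-suc : ∀ n → length (shapes (suc n)) ≡ convolution (length ∘ shapes) (length ∘ shapes) n
length-shapes-suc n = trans (length-products (shapesᶠ (suc n)) (shapesᶠ (suc n)) n)
                            (convolution-cong n fuel fuel)
  where
    fuel : ∀ {i} → i ≤ n → length (shapesᶠ (suc n) i) ≡ length (shapes i)
    fuel i≤n = cong length (shapesᶠ-fuel _ (s≤s i≤n) ≤-refl)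

-- Catalan numbers

convolution-last : ∀ F H n → convolution F H (suc n) ≡ convolution F (H ∘ suc) n + F (suc n) * H 0
convolution-last F H zero    = refl
convolution-last F H (suc n) =
  trans (cong (F 0 * H (2 + n) +_) (convolution-last (F ∘ suc) H n))
        (sym (+-assoc (F 0 * H (2 + n)) _ _))

-- The weights on the two sides add up to 2a + b·n on every term i + j = n.
convolution-weighted : ∀ a b F H n →
  convolution (λ i → (a + b * i) * F i) H n + convolution F (λ j → (a + b * j) * H j) n
    ≡ (2 * a + b * n) * convolution F H n
convolution-weighted a b F H = shifted 0 F
  where
    -- k is the number of leading terms of the original F already consumed by the recursion.
    shifted : ∀ k F n →
      convolution (λ i → (a + b * (k + i)) * F i) H n + convolution F (λ j → (a + b * j) * H j) n
        ≡ (2 * a + b * (k + n)) * convolution F H n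
    shifted k F zero = base a b k (F 0) (H 0)
      where
        base : ∀ a b k f h → (a + b * (k + 0)) * f * h + f * ((a + b * 0) * h) ≡ (2 * a + b * (k + 0)) * (f * h)
        base = solve-∀
    shifted k F (suc n) = begin
        (w + X) + (v + Y)
      ≡⟨ cong (λ X → (w + X) + (v + Y)) (convolution-cong n shift (λ _ → refl)) ⟩
        (w + X′) + (v + Y)
      ≡⟨ +-interchange w X′ v Y ⟩
        (w + v) + (X′ + Y)
      ≡⟨ cong ((w + v) +_) (shifted (suc k) (F ∘ suc) n) ⟩
        (w + v) + (2 * a + b * (suc k + n)) * Z
      ≡⟨ collect a b k n (F 0) (H (suc n)) Z ⟩
        (2 * a + b * (k + suc n)) * (F 0 * H (suc n) + Z)
      ∎
      where
        w  = (a + b * (k + 0)) * F 0 * H (suc n)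
        v  = F 0 * ((a + b * suc n) * H (suc n))
        X  = convolution (λ i → (a + b * (k + suc i)) * F (suc i)) H n
        X′ = convolution (λ i → (a + b * (suc k + i)) * F (suc i)) H n
        Y  = convolution (F ∘ suc) (λ j → (a + b * j) * H j) n
        Z  = convolution (F ∘ suc) H n
        shift : ∀ {i} → i ≤ n → (a + b * (k + suc i)) * F (suc i) ≡ (a + b * (suc k + i)) * F (suc i)
        shift {i} _ = cong (λ m → (a + b * m) * F (suc i)) (+-suc k i)
        collect : ∀ a b k n f h z →
          (a + b * (k + 0)) * f * h + f * ((a + b * suc n) * h) + (2 * a + b * (suc k + n)) * z
            ≡ (2 * a + b * (k + suc n)) * (f * h + z)
        collect = solve-∀

module _ (c : ℕ → ℕ) (c₀ : c 0 ≡ 1) (c-suc : ∀ n → c (suc n) ≡ convolution c c n) where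

  catalan-step : ∀ n → (2 + n) * c (suc n) ≡ (2 + 4 * n) * c n
  catalan-step = <-rec _ step
    where
      step : ∀ n → (∀ {i} → i < n → (2 + i) * c (suc i) ≡ (2 + 4 * i) * c i) →
             (2 + n) * c (suc n) ≡ (2 + 4 * n) * c n
      step zero _ = begin
        2 * c 1          ≡⟨ cong (2 *_) (c-suc 0) ⟩
        2 * (c 0 * c 0)  ≡⟨ cong (λ x → 2 * (x * x)) c₀ ⟩
        2                ≡⟨ cong (2 *_) c₀ ⟨
        2 * c 0          ∎
      step (suc n) IH = begin
          (3 + n) * c (2 + n)
        ≡⟨ cong (_* c (2 + n)) (3+n n) ⟩
          (2 * 1 + 1 * suc n) * c (2 + n)
        ≡⟨ cong ((2 * 1 + 1 * suc n) *_) (c-suc (suc n)) ⟩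
          (2 * 1 + 1 * suc n) * convolution c c (suc n)
        ≡⟨ convolution-weighted 1 1 c c (suc n) ⟨
          convolution x c (suc n) + convolution c x (suc n)
        ≡⟨ cong (convolution x c (suc n) +_) (convolution-last c x n) ⟩
          (x 0 * c (suc n) + convolution (x ∘ suc) c n) + (convolution c (x ∘ suc) n + c (suc n) * x 0)
        ≡⟨ cong₂ (λ p q → (x 0 * c (suc n) + p) + (q + c (suc n) * x 0))
                 (convolution-cong n x-suc≡y (λ _ → refl)) (convolution-cong n (λ _ → refl) x-suc≡y) ⟩
          (x 0 * c (suc n) + convolution y c n) + (convolution c y n + c (suc n) * x 0)
        ≡⟨ regroup (x 0) (c (suc n)) (convolution y c n) (convolution c y n) ⟩
          2 * (x 0 * c (suc n)) + (convolution y c n + convolution c y n)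
        ≡⟨ cong₂ (λ p q → 2 * (p * c (suc n)) + q) x₀ (convolution-weighted 2 4 c c n) ⟩
          2 * (1 * c (suc n)) + (2 * 2 + 4 * n) * convolution c c n
        ≡⟨ cong (λ z → 2 * (1 * c (suc n)) + (2 * 2 + 4 * n) * z) (c-suc n) ⟨
          2 * (1 * c (suc n)) + (2 * 2 + 4 * n) * c (suc n)
        ≡⟨ collect n (c (suc n)) ⟩
          (2 + 4 * suc n) * c (suc n)
        ∎
        where
          x y : ℕ → ℕ
          x i = (1 + 1 * i) * c i
          y i = (2 + 4 * i) * c i
          x₀ : x 0 ≡ 1
          x₀ = trans (+-identityʳ (c 0)) c₀
          1+1*[1+i] : ∀ i → 1 + 1 * suc i ≡ 2 + i
          1+1*[1+i] = solve-∀
          x-suc≡y : ∀ {i} → i ≤ n → x (suc i) ≡ y i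
          x-suc≡y {i} i≤n = trans (cong (_* c (suc i)) (1+1*[1+i] i)) (IH (s≤s i≤n))
          3+n : ∀ n → 3 + n ≡ 2 * 1 + 1 * suc n
          3+n = solve-∀
          regroup : ∀ p q r s → (p * q + r) + (s + q * p) ≡ 2 * (p * q) + (r + s)
          regroup = solve-∀
          collect : ∀ n d → 2 * (1 * d) + (2 * 2 + 4 * n) * d ≡ (2 + 4 * suc n) * d
          collect = solve-∀

  catalan-factorial : ∀ n → suc n * c n * (n ! * n !) ≡ (2 * n) !
  catalan-factorial zero    = cong (λ x → 1 * x * 1) c₀
  catalan-factorial (suc n) = begin
      (2 + n) * c (suc n) * (suc n ! * suc n !)
    ≡⟨ cong (_* (suc n ! * suc n !)) (catalan-step n) ⟩
      (2 + 4 * n) * c n * ((suc n * n !) * (suc n * n !))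
    ≡⟨ regroup n (c n) (n !) ⟩
      (2 + 2 * n) * ((1 + 2 * n) * (suc n * c n * (n ! * n !)))
    ≡⟨ cong (λ x → (2 + 2 * n) * ((1 + 2 * n) * x)) (catalan-factorial n) ⟩
      (2 + 2 * n) * ((1 + 2 * n) * (2 * n) !)
    ≡⟨ [2+2m]! n ⟨
      (2 * suc n) !
    ∎
    where
      regroup : ∀ n a f → (2 + 4 * n) * a * ((suc n * f) * (suc n * f))
                          ≡ (2 + 2 * n) * ((1 + 2 * n) * (suc n * a * (f * f)))
      regroup = solve-∀

  Catalan≡ : ∀ n → Catalan n ≡ c n
  Catalan≡ n = begin
      ((2 * n) C n) / suc n
    ≡⟨ cong (_/ suc n) central-binomial ⟩
      (suc n * c n) / suc n
    ≡⟨ cong (_/ suc n) (*-comm (suc n) (c n)) ⟩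
      (c n * suc n) / suc n
    ≡⟨ m*n/n≡m (c n) (suc n) ⟩
      c n
    ∎
    where
      2n∸n≡n : 2 * n ∸ n ≡ n
      2n∸n≡n = trans (m+n∸m≡n n (n + 0)) (+-identityʳ n)
      central-binomial : (2 * n) C n ≡ suc n * c n
      central-binomial = trans (nCk≡n!/k![n-k]! (m≤m+n n (n + 0)))
        (m≡n*o⇒m/o≡n _ _ _ {{m*n≢0 (n !) ((2 * n ∸ n) !) {{n !≢0}} {{(2 * n ∸ n) !≢0}}}}
          (sym (trans (cong (λ k → suc n * c n * (n ! * k !)) 2n∸n≡n) (catalan-factorial n))))

-- Bracketings

shape : Term n → Shape
shape (var _) = leaf
shape (a · b) = node (shape a) (shape b)

-- Only meaningful when xs has exactly suc (inner s) entries.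
label : Shape → List (Fin (suc n)) → Term (suc n)
label leaf       []      = var zero
label leaf       (x ∷ _) = var x
label (node a b) xs      = label a (take (suc (inner a)) xs) · label b (drop (suc (inner a)) xs)

shape-label : ∀ s (xs : List (Fin (suc n))) → shape (label s xs) ≡ s
shape-label leaf       []      = refl
shape-label leaf       (_ ∷ _) = refl
shape-label (node a b) xs      = cong₂ node (shape-label a _) (shape-label b _)

length-leaves : (t : Term n) → length (leaves t) ≡ suc (inner (shape t))
length-leaves (var _) = refl
length-leaves (a · b) = begin
  length (leaves a ++ leaves b)                ≡⟨ length-++ (leaves a) ⟩
  length (leaves a) + length (leaves b)        ≡⟨ cong₂ _+_ (length-leaves a) (length-leaves b) ⟩
  suc (inner (shape a)) + suc (inner (shape b)) ≡⟨ cong suc (+-suc _ _) ⟩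
  suc (inner (shape (a · b)))                  ∎

leaves-label : ∀ s (xs : List (Fin (suc n))) → length xs ≡ suc (inner s) → leaves (label s xs) ≡ xs
leaves-label leaf       (x ∷ []) _   = refl
leaves-label (node a b) xs       len =
  trans (cong₂ _++_ (leaves-label a _ length-take′) (leaves-label b _ length-drop′)) (take++drop≡id k xs)
  where
    k = suc (inner a)
    len′ : length xs ≡ k + suc (inner b)
    len′ = trans len (cong suc (sym (+-suc (inner a) (inner b))))
    length-take′ : length (take k xs) ≡ k
    length-take′ = trans (length-take k xs) (m≤n⇒m⊓n≡m (subst (k ≤_) (sym len′) (m≤m+n k _)))
    length-drop′ : length (drop k xs) ≡ suc (inner b)
    length-drop′ = trans (length-drop k xs) (trans (cong (_∸ k) len′) (m+n∸m≡n k _))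

shape-leaves-injective : {s t : Term n} → shape s ≡ shape t → leaves s ≡ leaves t → s ≡ t
shape-leaves-injective {s = var i} {var j} _ same-leaves = cong var (∷-injectiveˡ same-leaves)
shape-leaves-injective {s = a · b} {a′ · b′} same-shape same-leaves
  with node-injective same-shape
... | shape-a , shape-b with ++-injective (leaves a) length-a same-leaves
  where
    length-a : length (leaves a) ≡ length (leaves a′)
    length-a = trans (length-leaves a) (trans (cong (suc ∘ inner) shape-a) (sym (length-leaves a′)))
... | leaves-a , leaves-b = cong₂ _·_ (shape-leaves-injective shape-a leaves-a) (shape-leaves-injective shape-b leaves-b)

multiplicity : Fin n → List (Fin n) → ℕ
multiplicity i []       = 0
multiplicity i (x ∷ xs) = occ i (var x) + multiplicity i xs

multiplicity-++ : (i : Fin n) (xs ys : List (Fin n)) →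
                  multiplicity i (xs ++ ys) ≡ multiplicity i xs + multiplicity i ys
multiplicity-++ i []       ys = refl
multiplicity-++ i (x ∷ xs) ys =
  trans (cong (occ i (var x) +_) (multiplicity-++ i xs ys)) (sym (+-assoc (occ i (var x)) _ _))

occ≡multiplicity-leaves : (i : Fin n) (t : Term n) → occ i t ≡ multiplicity i (leaves t)
occ≡multiplicity-leaves i (var x) = sym (+-identityʳ _)
occ≡multiplicity-leaves i (a · b) =
  trans (cong₂ _+_ (occ≡multiplicity-leaves i a) (occ≡multiplicity-leaves i b))
        (sym (multiplicity-++ i (leaves a) (leaves b)))

multiplicity-zero-map-suc : (xs : List (Fin n)) → multiplicity zero (map suc xs) ≡ 0
multiplicity-zero-map-suc []       = refl
multiplicity-zero-map-suc (x ∷ xs) = multiplicity-zero-map-suc xs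

multiplicity-suc-map-suc : (i : Fin n) (xs : List (Fin n)) → multiplicity (suc i) (map suc xs) ≡ multiplicity i xs
multiplicity-suc-map-suc i []       = refl
multiplicity-suc-map-suc i (x ∷ xs) with i ≟ᶠ x
... | yes _ = cong suc (multiplicity-suc-map-suc i xs)
... | no _  = multiplicity-suc-map-suc i xs

multiplicity-allFin : ∀ n (i : Fin n) → multiplicity i (allFin n) ≡ 1
multiplicity-allFin (suc n) zero    =
  cong suc (trans (cong (multiplicity zero) (sym (map-tabulate {n = n} id suc))) (multiplicity-zero-map-suc (allFin n)))
multiplicity-allFin (suc n) (suc i) =
  trans (cong (multiplicity (suc i)) (sym (map-tabulate {n = n} id suc)))
        (trans (multiplicity-suc-map-suc i (allFin n)) (multiplicity-allFin n i))

leaves≡allFin⇒FullLinear : {t : Term n} → leaves t ≡ allFin n → FullLinear t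
leaves≡allFin⇒FullLinear {n} {t} leaves≡ i =
  trans (occ≡multiplicity-leaves i t) (trans (cong (multiplicity i) leaves≡) (multiplicity-allFin n i))

bracketings : ∀ m → List (Term (suc m))
bracketings m = map (λ s → label s (allFin (suc m))) (shapes m)

length-allFin : length (allFin n) ≡ n
length-allFin = length-tabulate id

length-bracketings : ∀ m → length (bracketings m) ≡ Catalan m
length-bracketings m =
  trans (length-map _ (shapes m)) (sym (Catalan≡ (length ∘ shapes) refl length-shapes-suc m))

∈-bracketings⇒Bracketing : ∀ {m t} → t ∈ bracketings m → Bracketing t
∈-bracketings⇒Bracketing {m} t∈ with ∈-map⁻ (λ s → label s (allFin (suc m))) t∈
... | s , s∈ , refl = leaves≡allFin⇒FullLinear {t = label s (allFin (suc m))} leaves≡ , leaves≡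
  where
    leaves≡ : leaves (label s (allFin (suc m))) ≡ allFin (suc m)
    leaves≡ = leaves-label s _ (trans length-allFin (cong suc (sym (inner-shapesᶠ (suc m) m s∈))))

Bracketing⇒∈-bracketings : ∀ {m} {t : Term (suc m)} → Bracketing t → t ∈ bracketings m
Bracketing⇒∈-bracketings {m} {t} (_ , leaves≡) =
  subst (_∈ bracketings m) (sym t≡) (∈-map⁺ (λ s → label s (allFin (suc m))) shape∈)
  where
    inner≡m : inner (shape t) ≡ m
    inner≡m = suc-injective (trans (sym (length-leaves t)) (trans (cong length leaves≡) length-allFin))
    shape∈ : shape t ∈ shapes m
    shape∈ = subst (λ k → shape t ∈ shapesᶠ (suc m) k) inner≡m (shapesᶠ-complete (shape t) (s≤s (≤-reflexive inner≡m)))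
    t≡ : t ≡ label (shape t) (allFin (suc m))
    t≡ = shape-leaves-injective (sym (shape-label (shape t) _))
           (trans leaves≡ (sym (leaves-label (shape t) _ (trans length-allFin (cong suc (sym inner≡m))))))

bracketings-unique : ∀ m → Unique (bracketings m)
bracketings-unique m = Unique.map⁺ label-injective (shapesᶠ-unique (suc m) m)
  where
    label-injective : ∀ {s s′} → label s (allFin (suc m)) ≡ label s′ (allFin (suc m)) → s ≡ s′
    label-injective {s} {s′} eq = trans (sym (shape-label s _)) (trans (cong shape eq) (shape-label s′ _))

numOps-of-enumeration : {G : Set} (_*_ : G → G → G) (P : Term n → Set) (ts : List (Term n)) →
  Unique ts → (∀ {t} → t ∈ ts → P t) → (∀ {t} → P t → t ∈ ts) →
  (∀ {s t} → P s → P t → SameOp _*_ s t → s ≡ t) → NumOps _*_ P (length ts)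
numOps-of-enumeration _*_ P ts unique sound complete faithful = v , P-v , distinct , covered
  where
    v = tabulateᵥ (lookup ts)
    lookup-v : ∀ i → lookupᵥ v i ≡ lookup ts i
    lookup-v = lookup∘tabulate (lookup ts)
    P-v : ∀ i → P (lookupᵥ v i)
    P-v i = subst P (sym (lookup-v i)) (sound (∈-lookup i))
    distinct : ∀ i j → SameOp _*_ (lookupᵥ v i) (lookupᵥ v j) → i ≡ j
    distinct i j same = lookup-injective unique
      (trans (sym (lookup-v i)) (trans (faithful (P-v i) (P-v j) same) (lookup-v j)))
    covered : ∀ t → P t → ∃ λ i → SameOp _*_ t (lookupᵥ v i)
    covered t pt = index (complete pt) , λ ρ →
      cong (eval _*_ ρ) (trans (lookup-index (complete pt)) (sym (lookup-v (index (complete pt)))))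

lemma4p3 : (G : Set) → G → (_*_ : G → G → G)
    → ((x y : G) → x * y ≡ y * x)
    → ((m : ℕ) → acSpectrum≡ _*_ (suc m) (D m))
    → (m : ℕ) → assocSpectrum≡ _*_ (suc m) (Catalan m)
lemma4p3 G _ _*_ comm spectrum m =
  subst (NumOps _*_ Bracketing) (length-bracketings m)
    (numOps-of-enumeration _*_ Bracketing (bracketings m) (bracketings-unique m)
       ∈-bracketings⇒Bracketing Bracketing⇒∈-bracketings sameOp⇒≡)
  where
    sameOp⇒≡ : {s t : Term (suc m)} → Bracketing s → Bracketing t → SameOp _*_ s t → s ≡ t
    sameOp⇒≡ (linear-s , leaves-s) (linear-t , leaves-t) same =
      ~-rigid (sameOp⇒~ comm (spectrum m) linear-s linear-t same)
              (trans leaves-s (sym leaves-t)) (≤-reflexive ∘ linear-t)
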